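{- For integers $r\ge 0$ and $n\ge 1$, \[h_n^{(r+1)}(2)=\frac{1}{2!\,r!}\sum_{k=1}^{r+1}\left[\begin{array}{c} r+1\\ k\end{array}\right]n^{k-1}\left\{\left(H_{n+r}^2-H_{n+r}^{(2)}\right)-2H_rH_{n+r}+H_r^2+H_r^{(2)}\right\},\] and \[h_n^{(r+1)}(3)=\frac{1}{3!\,r!}\sum_{k=1}^{r+1}\left[\begin{array}{c} r+1\\ k\end{array}\right]n^{k-1}\Big\{\left(H_{n+r}^3-3H_{n+r}H_{n+r}^{(2)}+2H_{n+r}^{(3)}\right)-3H_r\left(H_{n+r}^2-H_{n+r}^{(2)}\right)+3\left(H_r^2+H_r^{(2)}\right)H_{n+r}-\left(H_r^3+3H_rH_r^{(2)}+2H_r^{(3)}\right)\Big\}.\]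
   Context: For positive integers $k,m,n$, the generalized hyperharmonic number is \[h_n^{(m)}(k)=\sum_{\substack{1\le n_{m+k-1}<\cdots<n_m\\ \le n_{m-1}\le\cdots\le n_1\le n}}\frac{1}{n_m n_{m+1}\cdots n_{m+k-1}},\] i.e. the sum runs over integers with $1\le n_{m+k-1}<\cdots<n_m\le n_{m-1}\le\cdots\le n_1\le n$; and $h_n^{(m)}(k)=0$ when $n<k$. For integers $j\ge1$, $N\ge0$, $H_N^{(j)}=\sum_{i=1}^N i^{ -j}$ (empty sum $=0$) and $H_N=H_N^{(1)}$. The unsigned Stirling numbers of the first kind are defined by $x(x+1)\cdots(x+n-1)=\sum_{k=0}^{n}\left[\begin{array}{c} n\\ k\end{array}\right]x^k$. -}

module Defs where

open import Data.Nat using (ℕ; zero; suc; _^_; _!) renaming (_*_ to _*ℕ_; _+_ to _+ℕ_)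
open import Data.Integer using (+_)
open import Data.Rational using (ℚ; 0ℚ; 1ℚ; _+_; _*_; _/_)

Σ₁ : ℕ → (ℕ → ℚ) → ℚ
Σ₁ zero    f = 0ℚ
Σ₁ (suc m) f = Σ₁ m f + f (suc m)

ι : ℕ → ℚ
ι n = + n / 1

-- reciprocal 1/n of a positive natural (only ever applied to n ≥ 1)
inv : ℕ → ℚ
inv zero    = 0ℚ
inv (suc n) = + 1 / suc n

pow : ℚ → ℕ → ℚ
pow q zero    = 1ℚ
pow q (suc j) = q * pow q j

-- generalized harmonic number H_N^{(j)} = Σ_{i=1}^N 1 / i^j
H : ℕ → ℕ → ℚ
H j N = Σ₁ N (λ i → pow (inv i) j)

-- unsigned Stirling numbers of the first kind [n k], via the standard
-- recurrence coming from x(x+1)...(x+n) = (x(x+1)...(x+n-1))·(x+n)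
stirling : ℕ → ℕ → ℕ
stirling zero    zero    = 1
stirling zero    (suc k) = 0
stirling (suc n) zero    = 0
stirling (suc n) (suc k) = n *ℕ stirling n (suc k) +ℕ stirling n k

-- e k N = Σ_{1 ≤ a_k < ... < a_1 ≤ N} 1/(a_1 ⋯ a_k)
-- (split on whether the largest index a_1 equals N)
e : ℕ → ℕ → ℚ
e zero    N       = 1ℚ
e (suc k) zero    = 0ℚ
e (suc k) (suc N) = e (suc k) N + e k N * inv (suc N)

-- generalized hyperharmonic number h_n^{(m)}(k), m ≥ 1, written hh m k n:
--   hh 1 k n       = Σ_{1 ≤ n_k < ... < n_1 ≤ n} 1/(n_1 ⋯ n_k)
--   hh (m+1) k n   = Σ_{n_1 = 1}^{n} hh m k n_1
-- which is exactly the nested sum of the definition, peeling off the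
-- outermost (weak) index n_1 ≤ n.  (hh 0 is never used.)
hh : ℕ → ℕ → ℕ → ℚ
hh zero          k n = 0ℚ
hh (suc zero)    k n = e k n
hh (suc (suc m)) k n = Σ₁ n (λ j → hh (suc m) k j)

module Submission where

-- Write σₖ(r, n) for the k-th elementary symmetric function of the window
-- 1/(r+1), 1/(r+2), …, 1/(r+n) of reciprocals.  The proof has three parts.
--  (1) Closed form:  h_n^{(r+1)}(k) = C(n+r, r) · σₖ(r, n)  for k ≥ 1.  Induction
--      on r and n; it uses Pascal's rule and the absorption identity for
--      C(n+r, r) = (n+1)⋯(n+r) / r!, and the recursion for σₖ obtained by
--      removing the smallest element 1/(r+1) of the window.
--  (2) Newton's identities express σ₁, 2σ₂ and 6σ₃ of any finite sequence
--      through its power sums; the j-th power sum of the window is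
--      H^{(j)}_{n+r} - H^{(j)}_r.  Hence the bracket of the corollary for
--      k = 2, 3 equals k! · σₖ(r, n).
--  (3) Stirling numbers:  Σ_{k=1}^{r+1} [r+1, k] n^{k-1} = (n+1)⋯(n+r) = r! · C(n+r, r).
-- Substituting (2) and (3) into the right-hand side of the corollary gives
-- C(n+r, r) · σₖ(r, n), which is the left-hand side by (1).

open import Defs
open import Data.Nat using (ℕ; zero; suc; _^_; _!; _∸_; _≥_; _<_; s≤s; NonZero)
  renaming (_*_ to _*ℕ_; _+_ to _+ℕ_)
open import Data.Rational using (ℚ; mkℚ; 0ℚ; 1ℚ; _+_; _*_; _-_)
import Data.Rational.Properties as ℚ
import Data.Nat.Properties as ℕ
import Data.Integer as ℤ
import Data.Integer.Properties as ℤ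
import Data.Nat.Coprimality as Coprime
open import Data.Product using (_×_; _,_)
open import Relation.Binary.PropositionalEquality
open ≡-Reasoning

open import Data.Rational.Solver using (module +-*-Solver)
open +-*-Solver
open import Algebra.Properties.CommutativeSemigroup ℕ.+-commutativeSemigroup
  using () renaming (interchange to +-interchange)
open import Algebra.Properties.CommutativeSemigroup ℕ.*-commutativeSemigroup
  using () renaming (x∙yz≈y∙xz to *-left-comm; xy∙z≈xz∙y to *-right-comm)

-- The embedding ι : ℕ → ℚ and the reciprocals inv.  Both produce fractions
-- already in lowest terms, which lets us compute with them as explicit fractions.
private
  ι-mkℚ : ∀ n → ι n ≡ mkℚ (ℤ.+ n) 0 (Coprime.sym (Coprime.1-coprimeTo n))
  ι-mkℚ n = ℚ.normalize-coprime (Coprime.sym (Coprime.1-coprimeTo n))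

  inv-mkℚ : ∀ m → inv (suc m) ≡ mkℚ (ℤ.+ 1) m (Coprime.1-coprimeTo (suc m))
  inv-mkℚ m = ℚ.normalize-coprime (Coprime.1-coprimeTo (suc m))

ι-+ : ∀ a b → ι (a +ℕ b) ≡ ι a + ι b
ι-+ a b rewrite ι-mkℚ a | ι-mkℚ b =
  ℚ./-cong {ℤ.+ (a +ℕ b)} {1} {ℤ.+ a ℤ.* ℤ.+ 1 ℤ.+ ℤ.+ b ℤ.* ℤ.+ 1} {1}
    (trans (ℤ.pos-+ a b) (sym (cong₂ ℤ._+_ (ℤ.*-identityʳ (ℤ.+ a)) (ℤ.*-identityʳ (ℤ.+ b)))))
    refl

ι-* : ∀ a b → ι (a *ℕ b) ≡ ι a * ι b
ι-* a b rewrite ι-mkℚ a | ι-mkℚ b =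
  ℚ./-cong {ℤ.+ (a *ℕ b)} {1} {ℤ.+ a ℤ.* ℤ.+ b} {1} (ℤ.pos-* a b) refl

ι*inv : ∀ c → .{{_ : NonZero c}} → ι c * inv c ≡ 1ℚ
ι*inv (suc m) rewrite ι-mkℚ (suc m) | inv-mkℚ m =
  ℚ.*-inverseʳ (mkℚ (ℤ.+ suc m) 0 (Coprime.sym (Coprime.1-coprimeTo (suc m))))

inv-* : ∀ a b → .{{_ : NonZero a}} → .{{_ : NonZero b}} → inv (a *ℕ b) ≡ inv a * inv b
inv-* (suc a) (suc b) rewrite inv-mkℚ a | inv-mkℚ b = refl

inv-! : ∀ r → inv (suc r !) ≡ inv (suc r) * inv (r !)
inv-! r = inv-* (suc r) (r !) {{_}} {{r ℕ.!≢0}}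

Σℕ : ℕ → (ℕ → ℕ) → ℕ
Σℕ zero    f = 0
Σℕ (suc m) f = Σℕ m f +ℕ f (suc m)

Σ₁-cong : ∀ m {f g : ℕ → ℚ} → (∀ k → f (suc k) ≡ g (suc k)) → Σ₁ m f ≡ Σ₁ m g
Σ₁-cong zero    eq = refl
Σ₁-cong (suc m) eq = cong₂ _+_ (Σ₁-cong m eq) (eq m)

Σ₁-*ʳ : ∀ m (f : ℕ → ℚ) c → Σ₁ m (λ k → f k * c) ≡ Σ₁ m f * c
Σ₁-*ʳ zero    f c = sym (ℚ.*-zeroˡ c)
Σ₁-*ʳ (suc m) f c = trans (cong (_+ f (suc m) * c) (Σ₁-*ʳ m f c))
                          (sym (ℚ.*-distribʳ-+ c (Σ₁ m f) (f (suc m))))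

Σ₁-ι : ∀ m (f : ℕ → ℕ) → Σ₁ m (λ k → ι (f k)) ≡ ι (Σℕ m f)
Σ₁-ι zero    f = refl
Σ₁-ι (suc m) f = trans (cong (_+ ι (f (suc m))) (Σ₁-ι m f)) (sym (ι-+ (Σℕ m f) (f (suc m))))

Σℕ-cong : ∀ m {f g : ℕ → ℕ} → (∀ k → f (suc k) ≡ g (suc k)) → Σℕ m f ≡ Σℕ m g
Σℕ-cong zero    eq = refl
Σℕ-cong (suc m) eq = cong₂ _+ℕ_ (Σℕ-cong m eq) (eq m)

Σℕ-+ : ∀ m (f g : ℕ → ℕ) → Σℕ m (λ k → f k +ℕ g k) ≡ Σℕ m f +ℕ Σℕ m g
Σℕ-+ zero    f g = refl
Σℕ-+ (suc m) f g = begin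
    Σℕ m (λ k → f k +ℕ g k) +ℕ (f (suc m) +ℕ g (suc m))
      ≡⟨ cong (_+ℕ (f (suc m) +ℕ g (suc m))) (Σℕ-+ m f g) ⟩
    (Σℕ m f +ℕ Σℕ m g) +ℕ (f (suc m) +ℕ g (suc m))
      ≡⟨ +-interchange (Σℕ m f) (Σℕ m g) (f (suc m)) (g (suc m)) ⟩
    (Σℕ m f +ℕ f (suc m)) +ℕ (Σℕ m g +ℕ g (suc m)) ∎

Σℕ-*ˡ : ∀ m c (f : ℕ → ℕ) → Σℕ m (λ k → c *ℕ f k) ≡ c *ℕ Σℕ m f
Σℕ-*ˡ zero    c f = sym (ℕ.*-zeroʳ c)
Σℕ-*ˡ (suc m) c f = trans (cong (_+ℕ c *ℕ f (suc m)) (Σℕ-*ˡ m c f))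
                          (sym (ℕ.*-distribˡ-+ c (Σℕ m f) (f (suc m))))

Σℕ-first : ∀ m (f : ℕ → ℕ) → Σℕ (suc m) f ≡ f 1 +ℕ Σℕ m (λ k → f (suc k))
Σℕ-first zero    f = sym (ℕ.+-identityʳ (f 1))
Σℕ-first (suc m) f = trans (cong (_+ℕ f (suc (suc m))) (Σℕ-first m f)) (ℕ.+-assoc (f 1) _ _)

-- Elementary symmetric functions σ k x n = e_k(x 1, …, x n) of a sequence,
-- built by deciding whether the last element x n is used.

σ : ℕ → (ℕ → ℚ) → ℕ → ℚ
σ zero    x n       = 1ℚ
σ (suc k) x zero    = 0ℚ
σ (suc k) x (suc n) = σ (suc k) x n + σ k x n * x (suc n)

σ-cong : ∀ k n {x y : ℕ → ℚ} → (∀ i → x i ≡ y i) → σ k x n ≡ σ k y n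
σ-cong zero    n       eq = refl
σ-cong (suc k) zero    eq = refl
σ-cong (suc k) (suc n) eq = cong₂ _+_ (σ-cong (suc k) n eq) (cong₂ _*_ (σ-cong k n eq) (eq (suc n)))

σ-empty : ∀ k (x y : ℕ → ℚ) → σ k x 0 ≡ σ k y 0
σ-empty zero    x y = refl
σ-empty (suc k) x y = refl

σ-first : ∀ k n (x : ℕ → ℚ) →
  σ (suc k) x (suc n) ≡ σ (suc k) (λ i → x (suc i)) n + x 1 * σ k (λ i → x (suc i)) n
σ-first k zero x =
  cong (0ℚ +_) (trans (cong (_* x 1) (σ-empty k x (λ i → x (suc i))))
                      (ℚ.*-comm (σ k (λ i → x (suc i)) 0) (x 1)))
σ-first zero (suc n) x = begin
    σ 1 x (suc n) + 1ℚ * x (2 +ℕ n)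
      ≡⟨ cong (_+ 1ℚ * x (2 +ℕ n)) (σ-first zero n x) ⟩
    (σ 1 x′ n + x 1 * 1ℚ) + 1ℚ * x (2 +ℕ n)
      ≡⟨ solve 3 (λ s a b → (s :+ a :* con 1ℚ) :+ con 1ℚ :* b := (s :+ con 1ℚ :* b) :+ a :* con 1ℚ)
           refl (σ 1 x′ n) (x 1) (x (2 +ℕ n)) ⟩
    (σ 1 x′ n + 1ℚ * x (2 +ℕ n)) + x 1 * 1ℚ ∎
  where x′ = λ i → x (suc i)
σ-first (suc k) (suc n) x = begin
    σ (2 +ℕ k) x (suc n) + σ (suc k) x (suc n) * x (2 +ℕ n)
      ≡⟨ cong₂ (λ u v → u + v * x (2 +ℕ n)) (σ-first (suc k) n x) (σ-first k n x) ⟩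
    (S + a * T) + (T + a * U) * b
      ≡⟨ solve 5 (λ S T U a b → (S :+ a :* T) :+ (T :+ a :* U) :* b := (S :+ T :* b) :+ a :* (T :+ U :* b))
           refl S T U a b ⟩
    (S + T * b) + a * (T + U * b) ∎
  where
  x′ = λ i → x (suc i)
  S = σ (2 +ℕ k) x′ n
  T = σ (suc k) x′ n
  U = σ k x′ n
  a = x 1
  b = x (2 +ℕ n)

window : ℕ → ℕ → ℚ
window r i = inv (i +ℕ r)

e-window : ∀ k n → e k n ≡ σ k (window 0) n
e-window zero    n       = refl
e-window (suc k) zero    = refl
e-window (suc k) (suc n) =
  cong₂ _+_ (e-window (suc k) n)
    (cong₂ _*_ (e-window k n) (cong (λ t → inv (suc t)) (sym (ℕ.+-identityʳ n))))

σ-window-first : ∀ k r n →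
  σ (suc k) (window r) (suc n) ≡ σ (suc k) (window (suc r)) n + inv (suc r) * σ k (window (suc r)) n
σ-window-first k r n =
  trans (σ-first k n (window r))
        (cong₂ (λ u v → u + inv (suc r) * v) (σ-cong (suc k) n shift) (σ-cong k n shift))
  where
  shift : ∀ i → window r (suc i) ≡ window (suc r) i
  shift i = cong inv (sym (ℕ.+-suc i r))

-- Power sums p_j(x₁, …, x_n) and Newton's identities up to degree 3.  Each is
-- proved by induction on n: appending z = x_{n+1} adds z^j to p_j and
-- z · σ_{k-1} to σ_k, and the identity of the previous degree handles the latter.

powerSum : ℕ → (ℕ → ℚ) → ℕ → ℚ
powerSum j x n = Σ₁ n (λ i → pow (x i) j)

newton₁ : ∀ (x : ℕ → ℚ) n → σ 1 x n ≡ powerSum 1 x n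
newton₁ x zero    = refl
newton₁ x (suc n) = begin
    σ 1 x n + 1ℚ * x (suc n)
      ≡⟨ cong (_+ 1ℚ * x (suc n)) (newton₁ x n) ⟩
    powerSum 1 x n + 1ℚ * x (suc n)
      ≡⟨ solve 2 (λ p z → p :+ con 1ℚ :* z := p :+ z :* con 1ℚ) refl (powerSum 1 x n) (x (suc n)) ⟩
    powerSum 1 x n + x (suc n) * 1ℚ ∎

newton₂ : ∀ (x : ℕ → ℚ) n →
  ι 2 * σ 2 x n ≡ powerSum 1 x n * powerSum 1 x n - powerSum 2 x n
newton₂ x zero    = refl
newton₂ x (suc n) = begin
    ι 2 * (σ 2 x n + σ 1 x n * z)
      ≡⟨ solve 3 (λ s₂ s₁ z → con (ι 2) :* (s₂ :+ s₁ :* z) := con (ι 2) :* s₂ :+ con (ι 2) :* s₁ :* z)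
           refl (σ 2 x n) (σ 1 x n) z ⟩
    ι 2 * σ 2 x n + ι 2 * σ 1 x n * z
      ≡⟨ cong₂ (λ u v → u + ι 2 * v * z) (newton₂ x n) (newton₁ x n) ⟩
    (p₁ * p₁ - p₂) + ι 2 * p₁ * z
      ≡⟨ solve 3 (λ p₁ p₂ z → (p₁ :* p₁ :- p₂) :+ con (ι 2) :* p₁ :* z
                              := (p₁ :+ z :* con 1ℚ) :* (p₁ :+ z :* con 1ℚ) :- (p₂ :+ z :* (z :* con 1ℚ)))
           refl p₁ p₂ z ⟩
    (p₁ + z * 1ℚ) * (p₁ + z * 1ℚ) - (p₂ + z * (z * 1ℚ)) ∎
  where
  z = x (suc n)
  p₁ = powerSum 1 x n
  p₂ = powerSum 2 x n

newton₃ : ∀ (x : ℕ → ℚ) n →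
  ι 6 * σ 3 x n ≡ powerSum 1 x n * powerSum 1 x n * powerSum 1 x n
                  - ι 3 * powerSum 1 x n * powerSum 2 x n + ι 2 * powerSum 3 x n
newton₃ x zero    = refl
newton₃ x (suc n) = begin
    ι 6 * (σ 3 x n + σ 2 x n * z)
      ≡⟨ solve 3 (λ s₃ s₂ z → con (ι 6) :* (s₃ :+ s₂ :* z) := con (ι 6) :* s₃ :+ con (ι 3) :* (con (ι 2) :* s₂) :* z)
           refl (σ 3 x n) (σ 2 x n) z ⟩
    ι 6 * σ 3 x n + ι 3 * (ι 2 * σ 2 x n) * z
      ≡⟨ cong₂ (λ u v → u + ι 3 * v * z) (newton₃ x n) (newton₂ x n) ⟩
    (p₁ * p₁ * p₁ - ι 3 * p₁ * p₂ + ι 2 * p₃) + ι 3 * (p₁ * p₁ - p₂) * z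
      ≡⟨ solve 4 (λ p₁ p₂ p₃ z →
             (p₁ :* p₁ :* p₁ :- con (ι 3) :* p₁ :* p₂ :+ con (ι 2) :* p₃) :+ con (ι 3) :* (p₁ :* p₁ :- p₂) :* z
             := (p₁ :+ z :* con 1ℚ) :* (p₁ :+ z :* con 1ℚ) :* (p₁ :+ z :* con 1ℚ)
                :- con (ι 3) :* (p₁ :+ z :* con 1ℚ) :* (p₂ :+ z :* (z :* con 1ℚ))
                :+ con (ι 2) :* (p₃ :+ z :* (z :* (z :* con 1ℚ))))
           refl p₁ p₂ p₃ z ⟩
    (p₁ + z * 1ℚ) * (p₁ + z * 1ℚ) * (p₁ + z * 1ℚ)
      - ι 3 * (p₁ + z * 1ℚ) * (p₂ + z * (z * 1ℚ)) + ι 2 * (p₃ + z * (z * (z * 1ℚ))) ∎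
  where
  z = x (suc n)
  p₁ = powerSum 1 x n
  p₂ = powerSum 2 x n
  p₃ = powerSum 3 x n

window-powerSum : ∀ j r n → powerSum j (window r) n ≡ H j (n +ℕ r) - H j r
window-powerSum j r zero    = sym (ℚ.+-inverseʳ (H j r))
window-powerSum j r (suc n) = begin
    powerSum j (window r) n + z
      ≡⟨ cong (_+ z) (window-powerSum j r n) ⟩
    (H j (n +ℕ r) - H j r) + z
      ≡⟨ solve 3 (λ A a z → (A :- a) :+ z := (A :+ z) :- a) refl (H j (n +ℕ r)) (H j r) z ⟩
    (H j (n +ℕ r) + z) - H j r ∎
  where z = pow (inv (suc (n +ℕ r))) j

bracket₂ : ∀ r n →
  ((H 1 (n +ℕ r) * H 1 (n +ℕ r) - H 2 (n +ℕ r)) - ι 2 * H 1 r * H 1 (n +ℕ r)) + H 1 r * H 1 r + H 2 r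
    ≡ ι (2 !) * σ 2 (window r) n
bracket₂ r n = begin
    ((A * A - B) - ι 2 * a * A) + a * a + b
      ≡⟨ solve 4 (λ A B a b → ((A :* A :- B) :- con (ι 2) :* a :* A) :+ a :* a :+ b
                              := (A :- a) :* (A :- a) :- (B :- b)) refl A B a b ⟩
    (A - a) * (A - a) - (B - b)
      ≡⟨ sym (cong₂ (λ p₁ p₂ → p₁ * p₁ - p₂) (window-powerSum 1 r n) (window-powerSum 2 r n)) ⟩
    powerSum 1 (window r) n * powerSum 1 (window r) n - powerSum 2 (window r) n
      ≡⟨ sym (newton₂ (window r) n) ⟩
    ι 2 * σ 2 (window r) n ∎
  where
  A = H 1 (n +ℕ r)
  B = H 2 (n +ℕ r)
  a = H 1 r
  b = H 2 r

bracket₃ : ∀ r n →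
  (((H 1 (n +ℕ r) * H 1 (n +ℕ r) * H 1 (n +ℕ r) - ι 3 * H 1 (n +ℕ r) * H 2 (n +ℕ r) + ι 2 * H 3 (n +ℕ r))
     - ι 3 * H 1 r * (H 1 (n +ℕ r) * H 1 (n +ℕ r) - H 2 (n +ℕ r)))
    + ι 3 * (H 1 r * H 1 r + H 2 r) * H 1 (n +ℕ r))
    - (H 1 r * H 1 r * H 1 r + ι 3 * H 1 r * H 2 r + ι 2 * H 3 r)
    ≡ ι (3 !) * σ 3 (window r) n
bracket₃ r n = begin
    (((A * A * A - ι 3 * A * B + ι 2 * C) - ι 3 * a * (A * A - B)) + ι 3 * (a * a + b) * A)
      - (a * a * a + ι 3 * a * b + ι 2 * c)
      ≡⟨ solve 6 (λ A B C a b c →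
             (((A :* A :* A :- con (ι 3) :* A :* B :+ con (ι 2) :* C) :- con (ι 3) :* a :* (A :* A :- B))
               :+ con (ι 3) :* (a :* a :+ b) :* A) :- (a :* a :* a :+ con (ι 3) :* a :* b :+ con (ι 2) :* c)
             := (A :- a) :* (A :- a) :* (A :- a) :- con (ι 3) :* (A :- a) :* (B :- b) :+ con (ι 2) :* (C :- c))
           refl A B C a b c ⟩
    (A - a) * (A - a) * (A - a) - ι 3 * (A - a) * (B - b) + ι 2 * (C - c)
      ≡⟨ sym (cong (λ q₃ → (A - a) * (A - a) * (A - a) - ι 3 * (A - a) * (B - b) + ι 2 * q₃)
               (window-powerSum 3 r n)) ⟩
    (A - a) * (A - a) * (A - a) - ι 3 * (A - a) * (B - b) + ι 2 * p₃
      ≡⟨ sym (cong₂ (λ q₁ q₂ → q₁ * q₁ * q₁ - ι 3 * q₁ * q₂ + ι 2 * p₃)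
               (window-powerSum 1 r n) (window-powerSum 2 r n)) ⟩
    p₁ * p₁ * p₁ - ι 3 * p₁ * p₂ + ι 2 * p₃
      ≡⟨ sym (newton₃ (window r) n) ⟩
    ι 6 * σ 3 (window r) n ∎
  where
  A = H 1 (n +ℕ r)
  B = H 2 (n +ℕ r)
  C = H 3 (n +ℕ r)
  a = H 1 r
  b = H 2 r
  c = H 3 r
  p₁ = powerSum 1 (window r) n
  p₂ = powerSum 2 (window r) n
  p₃ = powerSum 3 (window r) n

-- The rising factorial rising r n = (n+1)(n+2)⋯(n+r) and the binomial
-- coefficient binom r n = C(n+r, r) = rising r n / r!.

rising : ℕ → ℕ → ℕ
rising zero    n = 1
rising (suc r) n = rising r n *ℕ suc (r +ℕ n)

binom : ℕ → ℕ → ℚ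
binom r n = ι (rising r n) * inv (r !)

rising-shift : ∀ r m → rising r (suc m) *ℕ suc m ≡ rising r m *ℕ suc (r +ℕ m)
rising-shift zero    m = refl
rising-shift (suc r) m = begin
    rising r (suc m) *ℕ suc (r +ℕ suc m) *ℕ suc m
      ≡⟨ *-right-comm (rising r (suc m)) _ (suc m) ⟩
    rising r (suc m) *ℕ suc m *ℕ suc (r +ℕ suc m)
      ≡⟨ cong₂ _*ℕ_ (rising-shift r m) (cong suc (ℕ.+-suc r m)) ⟩
    rising r m *ℕ suc (r +ℕ m) *ℕ suc (suc r +ℕ m) ∎

-- Pascal's rule C(m+r+2, r+1) = C(m+r+1, r+1) + C(m+r+1, r), multiplied by (r+1)!.
rising-pascal : ∀ r m → rising (suc r) (suc m) ≡ rising (suc r) m +ℕ suc r *ℕ rising r (suc m)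
rising-pascal r m = begin
    R *ℕ suc (r +ℕ suc m)
      ≡⟨ cong (R *ℕ_) (ℕ.+-comm (suc r) (suc m)) ⟩
    R *ℕ (suc m +ℕ suc r)
      ≡⟨ ℕ.*-distribˡ-+ R (suc m) (suc r) ⟩
    R *ℕ suc m +ℕ R *ℕ suc r
      ≡⟨ cong₂ _+ℕ_ (rising-shift r m) (ℕ.*-comm R (suc r)) ⟩
    rising r m *ℕ suc (r +ℕ m) +ℕ suc r *ℕ R ∎
  where R = rising r (suc m)

pascal : ∀ r m → binom (suc r) (suc m) ≡ binom (suc r) m + binom r (suc m)
pascal r m = begin
    ι (rising (suc r) (suc m)) * inv (suc r !)
      ≡⟨ cong₂ _*_ (trans (cong ι (rising-pascal r m)) (ι-sum-product Q (suc r) P)) (inv-! r) ⟩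
    (ι Q + ι (suc r) * ι P) * (inv (suc r) * inv (r !))
      ≡⟨ solve 5 (λ q c p x y → (q :+ c :* p) :* (x :* y) := q :* (x :* y) :+ (c :* x) :* (p :* y))
           refl (ι Q) (ι (suc r)) (ι P) (inv (suc r)) (inv (r !)) ⟩
    ι Q * (inv (suc r) * inv (r !)) + (ι (suc r) * inv (suc r)) * binom r (suc m)
      ≡⟨ cong₂ (λ u v → ι Q * u + v * binom r (suc m)) (sym (inv-! r)) (ι*inv (suc r)) ⟩
    binom (suc r) m + 1ℚ * binom r (suc m)
      ≡⟨ cong (binom (suc r) m +_) (ℚ.*-identityˡ (binom r (suc m))) ⟩
    binom (suc r) m + binom r (suc m) ∎
  where
  P = rising r (suc m)
  Q = rising (suc r) m
  ι-sum-product : ∀ a b c → ι (a +ℕ b *ℕ c) ≡ ι a + ι b * ι c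
  ι-sum-product a b c = trans (ι-+ a (b *ℕ c)) (cong (ι a +_) (ι-* b c))

absorption : ∀ r m → binom (suc r) (suc m) * inv (suc (m +ℕ suc r)) ≡ binom r (suc m) * inv (suc r)
absorption r m = begin
    ι (P *ℕ c) * inv (suc r !) * inv c′
      ≡⟨ cong₂ (λ u v → u * v * inv c′) (ι-* P c) (inv-! r) ⟩
    ι P * ι c * (inv (suc r) * inv (r !)) * inv c′
      ≡⟨ solve 5 (λ p j x y z → p :* j :* (x :* y) :* z := (j :* z) :* (p :* y :* x))
           refl (ι P) (ι c) (inv (suc r)) (inv (r !)) (inv c′) ⟩
    (ι c * inv c′) * (binom r (suc m) * inv (suc r))
      ≡⟨ cong (λ t → (ι t * inv c′) * (binom r (suc m) * inv (suc r))) c≡c′ ⟩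
    (ι c′ * inv c′) * (binom r (suc m) * inv (suc r))
      ≡⟨ cong (_* (binom r (suc m) * inv (suc r))) (ι*inv c′) ⟩
    1ℚ * (binom r (suc m) * inv (suc r))
      ≡⟨ ℚ.*-identityˡ _ ⟩
    binom r (suc m) * inv (suc r) ∎
  where
  P = rising r (suc m)
  c = suc (r +ℕ suc m)
  c′ = suc (m +ℕ suc r)
  c≡c′ : c ≡ c′
  c≡c′ = cong suc (trans (ℕ.+-comm r (suc m)) (sym (ℕ.+-suc m r)))

hh-closedForm : ∀ r k n → hh (suc r) (suc k) n ≡ binom r n * σ (suc k) (window r) n
hh-closedForm zero    k n       = trans (e-window (suc k) n) (sym (ℚ.*-identityˡ _))
hh-closedForm (suc r) k zero    = sym (ℚ.*-zeroʳ (binom (suc r) 0))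
hh-closedForm (suc r) k (suc n) = begin
    hh (2 +ℕ r) (suc k) n + hh (suc r) (suc k) (suc n)
      ≡⟨ cong₂ _+_ (hh-closedForm (suc r) k n)
           (trans (hh-closedForm r k (suc n)) (cong (binom r (suc n) *_) (σ-window-first k r n))) ⟩
    b₀ * S + b₂ * (S + x * T)
      ≡⟨ solve 5 (λ b₀ b₂ S T x → b₀ :* S :+ b₂ :* (S :+ x :* T) := (b₀ :+ b₂) :* S :+ (b₂ :* x) :* T)
           refl b₀ b₂ S T x ⟩
    (b₀ + b₂) * S + (b₂ * x) * T
      ≡⟨ cong₂ (λ u v → u * S + v * T) (sym (pascal r n)) (sym (absorption r n)) ⟩
    b₁ * S + (b₁ * y) * T
      ≡⟨ solve 4 (λ b₁ S T y → b₁ :* S :+ (b₁ :* y) :* T := b₁ :* (S :+ T :* y)) refl b₁ S T y ⟩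
    b₁ * (S + T * y) ∎
  where
  b₀ = binom (suc r) n
  b₁ = binom (suc r) (suc n)
  b₂ = binom r (suc n)
  S = σ (suc k) (window (suc r)) n
  T = σ k (window (suc r)) n
  x = inv (suc r)
  y = inv (suc (n +ℕ suc r))

stirling-vanishes : ∀ {n k} → n < k → stirling n k ≡ 0
stirling-vanishes {zero}  {suc k} _          = refl
stirling-vanishes {suc n} {suc k} (s≤s n<k) =
  cong₂ _+ℕ_ (trans (cong (n *ℕ_) (stirling-vanishes (ℕ.m<n⇒m<1+n n<k))) (ℕ.*-zeroʳ n))
             (stirling-vanishes n<k)

stirlingSum : ℕ → ℕ → ℕ
stirlingSum m x = Σℕ (suc m) (λ k → stirling (suc m) k *ℕ x ^ (k ∸ 1))

stirling-extend : ∀ m (g : ℕ → ℕ) →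
  Σℕ (suc (suc m)) (λ k → stirling (suc m) k *ℕ g k) ≡ Σℕ (suc m) (λ k → stirling (suc m) k *ℕ g k)
stirling-extend m g =
  trans (cong (λ s → Σℕ (suc m) (λ k → stirling (suc m) k *ℕ g k) +ℕ s *ℕ g (suc (suc m)))
              (stirling-vanishes (ℕ.n<1+n (suc m))))
        (ℕ.+-identityʳ _)

-- The contribution of the term [m+1, k-1] of the recurrence: multiplication by x.
stirling-shifted : ∀ m x →
  Σℕ (suc (suc m)) (λ k → stirling (suc m) (k ∸ 1) *ℕ x ^ (k ∸ 1)) ≡ x *ℕ stirlingSum m x
stirling-shifted m x = begin
    Σℕ (suc (suc m)) (λ k → stirling (suc m) (k ∸ 1) *ℕ x ^ (k ∸ 1))
      ≡⟨ Σℕ-first (suc m) _ ⟩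
    Σℕ (suc m) (λ k → stirling (suc m) k *ℕ x ^ k)
      ≡⟨ Σℕ-cong (suc m) (λ j → *-left-comm (stirling (suc m) (suc j)) x (x ^ j)) ⟩
    Σℕ (suc m) (λ k → x *ℕ (stirling (suc m) k *ℕ x ^ (k ∸ 1)))
      ≡⟨ Σℕ-*ˡ (suc m) x _ ⟩
    x *ℕ stirlingSum m x ∎

-- x(x+1)⋯(x+m) · (x+m+1) = x(x+1)⋯(x+m+1), read off coefficientwise.
stirlingSum-step : ∀ m x → stirlingSum (suc m) x ≡ stirlingSum m x *ℕ suc (m +ℕ x)
stirlingSum-step m x = begin
    stirlingSum (suc m) x
      ≡⟨ Σℕ-cong (suc (suc m)) recurrence ⟩
    Σℕ (suc (suc m)) (λ k → suc m *ℕ (stirling (suc m) k *ℕ x ^ (k ∸ 1))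
                            +ℕ stirling (suc m) (k ∸ 1) *ℕ x ^ (k ∸ 1))
      ≡⟨ Σℕ-+ (suc (suc m)) _ _ ⟩
    Σℕ (suc (suc m)) (λ k → suc m *ℕ (stirling (suc m) k *ℕ x ^ (k ∸ 1)))
      +ℕ Σℕ (suc (suc m)) (λ k → stirling (suc m) (k ∸ 1) *ℕ x ^ (k ∸ 1))
      ≡⟨ cong₂ _+ℕ_ (trans (Σℕ-*ˡ (suc (suc m)) (suc m) _)
                           (cong (suc m *ℕ_) (stirling-extend m (λ k → x ^ (k ∸ 1)))))
                    (stirling-shifted m x) ⟩
    suc m *ℕ stirlingSum m x +ℕ x *ℕ stirlingSum m x
      ≡⟨ sym (ℕ.*-distribʳ-+ (stirlingSum m x) (suc m) x) ⟩
    (suc m +ℕ x) *ℕ stirlingSum m x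
      ≡⟨ ℕ.*-comm (suc m +ℕ x) (stirlingSum m x) ⟩
    stirlingSum m x *ℕ suc (m +ℕ x) ∎
  where
  recurrence : ∀ j → stirling (suc (suc m)) (suc j) *ℕ x ^ j
                   ≡ suc m *ℕ (stirling (suc m) (suc j) *ℕ x ^ j) +ℕ stirling (suc m) j *ℕ x ^ j
  recurrence j = trans (ℕ.*-distribʳ-+ (x ^ j) (suc m *ℕ stirling (suc m) (suc j)) (stirling (suc m) j))
                       (cong (_+ℕ stirling (suc m) j *ℕ x ^ j) (ℕ.*-assoc (suc m) (stirling (suc m) (suc j)) (x ^ j)))

stirlingSum≡rising : ∀ m x → stirlingSum m x ≡ rising m x
stirlingSum≡rising zero    x = refl
stirlingSum≡rising (suc m) x =
  trans (stirlingSum-step m x) (cong (_*ℕ suc (m +ℕ x)) (stirlingSum≡rising m x))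

-- The same identity read in ℚ, in the shape it has in the corollary.
stirlingSumℚ : ∀ r n → Σ₁ (suc r) (λ j → ι (stirling (suc r) j) * ι (n ^ (j ∸ 1))) ≡ ι (rising r n)
stirlingSumℚ r n =
  trans (Σ₁-cong (suc r) (λ j → sym (ι-* (stirling (suc r) (suc j)) (n ^ j))))
        (trans (Σ₁-ι (suc r) (λ j → stirling (suc r) j *ℕ n ^ (j ∸ 1)))
               (cong ι (stirlingSum≡rising r n)))

hh-from-bracket : ∀ K k r n (b : ℚ) → .{{_ : NonZero K}} → b ≡ ι K * σ (suc k) (window r) n →
  hh (suc r) (suc k) n ≡ inv (K *ℕ r !) * Σ₁ (suc r) (λ j → ι (stirling (suc r) j) * ι (n ^ (j ∸ 1)) * b)
hh-from-bracket K k r n b {{K≢0}} b≡Kσ = sym (begin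
    inv (K *ℕ r !) * Σ₁ (suc r) (λ j → c j * b)
      ≡⟨ cong (inv (K *ℕ r !) *_) (Σ₁-*ʳ (suc r) c b) ⟩
    inv (K *ℕ r !) * (Σ₁ (suc r) c * b)
      ≡⟨ cong₂ (λ u v → inv (K *ℕ r !) * (u * v)) (stirlingSumℚ r n) b≡Kσ ⟩
    inv (K *ℕ r !) * (ι (rising r n) * (ι K * s))
      ≡⟨ cong (_* (ι (rising r n) * (ι K * s))) (inv-* K (r !) {{K≢0}} {{r ℕ.!≢0}}) ⟩
    (inv K * inv (r !)) * (ι (rising r n) * (ι K * s))
      ≡⟨ solve 5 (λ x y p q z → (x :* y) :* (p :* (q :* z)) := (q :* x) :* (p :* y :* z))
           refl (inv K) (inv (r !)) (ι (rising r n)) (ι K) s ⟩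
    (ι K * inv K) * (binom r n * s)
      ≡⟨ cong (_* (binom r n * s)) (ι*inv K) ⟩
    1ℚ * (binom r n * s)
      ≡⟨ ℚ.*-identityˡ _ ⟩
    binom r n * s
      ≡⟨ sym (hh-closedForm r k n) ⟩
    hh (suc r) (suc k) n ∎)
  where
  c = λ j → ι (stirling (suc r) j) * ι (n ^ (j ∸ 1))
  s = σ (suc k) (window r) n

corollary2p3 : (r n : ℕ) → n ≥ 1 →
    (hh (suc r) 2 n
      ≡ inv (2 ! *ℕ r !)
        * Σ₁ (suc r) (λ k → ι (stirling (suc r) k) * ι (n ^ (k ∸ 1))
            * (((H 1 (n +ℕ r) * H 1 (n +ℕ r) - H 2 (n +ℕ r))
                - ι 2 * H 1 r * H 1 (n +ℕ r))
               + H 1 r * H 1 r + H 2 r)))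
    ×
    (hh (suc r) 3 n
      ≡ inv (3 ! *ℕ r !)
        * Σ₁ (suc r) (λ k → ι (stirling (suc r) k) * ι (n ^ (k ∸ 1))
            * ((((H 1 (n +ℕ r) * H 1 (n +ℕ r) * H 1 (n +ℕ r)
                   - ι 3 * H 1 (n +ℕ r) * H 2 (n +ℕ r)
                   + ι 2 * H 3 (n +ℕ r))
                - ι 3 * H 1 r * (H 1 (n +ℕ r) * H 1 (n +ℕ r) - H 2 (n +ℕ r)))
               + ι 3 * (H 1 r * H 1 r + H 2 r) * H 1 (n +ℕ r))
               - (H 1 r * H 1 r * H 1 r + ι 3 * H 1 r * H 2 r + ι 2 * H 3 r))))
corollary2p3 r n _ = hh-from-bracket (2 !) 1 r n _ (bracket₂ r n)
                   , hh-from-bracket (3 !) 2 r n _ (bracket₃ r n)
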